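{- Let $L=\{001,110\}$. Then $\mathcal{G}_L$ is exactly the class of bipartite chain graphs.
   Context: All graphs are finite, simple, undirected, with nonempty vertex sets, and graph classes are considered up to isomorphism. A bipartite graph $G$ with partition classes $A,B$ is a bipartite chain graph if there is a linear ordering $\leq_A$ on $A$ such that $a_1\leq_A a_2$ implies $N(a_1)\subseteq N(a_2)$ for all $a_1,a_2\in A$ ($N$ denotes the neighborhood). For an alphabet $V$ and distinct $u,v\in V$, $h_{u,v}:V^*\to\{0,1\}^*$ is the monoid morphism with $u\mapsto 0$, $v\mapsto 1$ and $x\mapsto\lambda$ (empty word) for all other letters $x$. For a language $L\subseteq\{0,1\}^*$ closed under exchanging 0 and 1 and a nonempty word $w$ whose set of occurring letters is $V$, $G(L,w)$ is the graph with vertex set $V$ in which distinct $u,v$ are adjacent iff $h_{u,v}(w)\in L$. $\mathcal{G}_L$ is the class of all graphs isomorphic to some $G(L,w)$. -}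

module Defs where

open import Data.Nat using (ℕ; NonZero)
open import Data.Fin using (Fin; _≟_)
open import Data.Bool using (Bool; true; false; if_then_else_)
open import Data.List using (List; []; _∷_)
open import Data.List.Membership.Propositional using (_∈_)
open import Data.Product using (Σ; ∃; ∃-syntax; _×_; _,_)
open import Function.Bundles using (_↔_; Inverse; _⇔_)
open import Relation.Binary.PropositionalEquality using (_≡_; _≢_)
open import Relation.Binary.Structures using (IsTotalOrder)
open import Relation.Nullary.Decidable using (⌊_⌋; yes; no)
open import Level using (0ℓ)

Adj : ℕ → Set
Adj n = Fin n → Fin n → Bool

IsSimple : ∀ {n} → Adj n → Set
IsSimple {n} adj = (∀ x y → adj x y ≡ adj y x) × (∀ x → adj x x ≡ false)

Iso : ∀ {m n} → Adj m → Adj n → Set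
Iso {m} {n} adjG adjH =
  Σ (Fin m ↔ Fin n) λ f → ∀ x y → adjH (Inverse.to f x) (Inverse.to f y) ≡ adjG x y

-- the morphism h_{u,v} : u ↦ 0 (false), v ↦ 1 (true), other letters ↦ λ
h : ∀ {n} → Fin n → Fin n → List (Fin n) → List Bool
h u v [] = []
h u v (x ∷ w) with x ≟ u | x ≟ v
... | yes _ | _     = false ∷ h u v w
... | no _  | yes _ = true ∷ h u v w
... | no _  | no _  = h u v w

inL : List Bool → Bool
inL (false ∷ false ∷ true ∷ []) = true
inL (true ∷ true ∷ false ∷ []) = true
inL _ = false

AllOccur : ∀ {n} → List (Fin n) → Set
AllOccur {n} w = ∀ (x : Fin n) → x ∈ w

-- G(L,w): vertex set = letters of w (here Fin n), distinct u,v adjacent iff h_{u,v}(w) ∈ L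
GLw : ∀ {n} → List (Fin n) → Adj n
GLw w u v = if ⌊ u ≟ v ⌋ then false else inL (h u v w)

InGL : ∀ {n} → Adj n → Set
InGL {n} adj = ∃[ m ] Σ (List (Fin m)) λ w → AllOccur w × Iso (GLw w) adj

NSub : ∀ {n} → Adj n → Fin n → Fin n → Set
NSub {n} adj a b = ∀ (x : Fin n) → adj a x ≡ true → adj b x ≡ true

IsBipartiteChain : ∀ {n} → Adj n → Set₁
IsBipartiteChain {n} adj =
  Σ (Fin n → Bool) λ side →
    (∀ x y → adj x y ≡ true → side x ≢ side y) ×
    Σ (Σ (Fin n) (λ a → side a ≡ true) → Σ (Fin n) (λ a → side a ≡ true) → Set) λ _≤A_ →
      IsTotalOrder _≡_ _≤A_ ×
      (∀ a₁ a₂ → a₁ ≤A a₂ → NSub adj (Data.Product.proj₁ a₁) (Data.Product.proj₁ a₂))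

-- In G(L, w) two letters are adjacent exactly when one of them, a, occurs twice in w, the other,
-- x, occurs once, and x comes after both copies of a. Hence letters occurring twice and letters
-- occurring once form a bipartition, and the neighbourhood of a twice-occurring a consists of the
-- once-occurring x with no a in the suffix of w after x. These suffixes are linearly ordered, so
-- the neighbourhoods are nested; breaking ties by vertex index turns nestedness into a linear order.
-- Conversely, given nested neighbourhoods, write each a ∈ A twice and each b ∈ B once, sorted by
-- 2·up(a) resp. 2·deg(b) + 1, where up(a) counts the vertices whose neighbourhood contains N(a).
-- Nestedness gives a ∼ b ⇔ up(a) ≤ deg(b), i.e. the copies of a precede b exactly when a ∼ b.
module Submission where

open import Algebra.Core using (Op₂)
open import Algebra.Structures using (IsMonoid)
open import Axiom.UniquenessOfIdentityProofs using (module Decidable⇒UIP)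
open import Data.Bool using (Bool; true; false; not; if_then_else_)
import Data.Bool.Properties as Bool
open import Data.Empty using (⊥-elim)
open import Data.Fin as Fin using (Fin; zero; suc; toℕ; fromℕ<; _≟_)
open import Data.Fin.Properties using (all?; ¬∀⟶∃¬; suc-injective; toℕ-injective; toℕ-fromℕ<; <-irrefl)
open import Data.Fin.Subset using (Subset; ∣_∣) renaming (_∈_ to _∈ₛ_)
open import Data.Fin.Subset.Properties using (p⊆q⇒∣p∣≤∣q∣; p⊂q⇒∣p∣<∣q∣; ∣p∣≤n)
open import Data.List using (List; []; _∷_; _++_; replicate; length; filter; filterᵇ; concat; tabulate)
open import Data.List.Membership.Propositional using (_∈_)
open import Data.List.Properties
  using (length-++; length-replicate; filter-++; filter-accept; filter-reject; filter-all; filter-none; ++-isMonoid)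
open import Data.List.Relation.Binary.Suffix.Heterogeneous using (Suffix; here; there)
open import Data.List.Relation.Binary.Suffix.Heterogeneous.Properties using (length-mono; filter⁺)
import Data.List.Relation.Binary.Pointwise as Pointwise
open import Data.List.Relation.Unary.All.Properties using (replicate⁺)
open import Data.List.Relation.Unary.Any using (here; there)
open import Data.Nat using (ℕ; zero; suc; NonZero; _+_; _≤_; _<_; _≡ᵇ_; s≤s; z≤n)
open import Data.Nat.Properties
  using (+-0-isMonoid; +-identityʳ; +-mono-≤; +-suc; m≤n⇒m≤1+n; n≤0⇒n≡0;
         ≤-refl; ≤-reflexive; ≤-trans; ≤-antisym; ≤-total; ≡ᵇ⇒≡)
import Data.Nat.Properties as ℕ
open import Data.Product using (Σ; ∃; _×_; _,_; proj₁; proj₂)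
open import Data.Sum as Sum using (_⊎_; inj₁; inj₂; [_,_])
open import Data.Vec as Vec using ()
open import Data.Vec.Properties using (lookup∘tabulate; []=⇒lookup; lookup⇒[]=)
open import Defs
open import Function using (_∘_; id; const; _on_; _⇔_; mk⇔; Equivalence; Inverse; Injective)
open import Function.Properties.Inverse using (↔-refl)
open import Level using (0ℓ)
open import Relation.Binary
  using (Rel; IsPreorder; IsTotalPreorder; IsTotalOrder; Transitive; Antisymmetric; Total; Decidable; _⇒_)
open import Relation.Binary.PropositionalEquality
  using (_≡_; _≢_; refl; sym; trans; cong; cong₂; subst; subst₂; isEquivalence; module ≡-Reasoning)
open import Relation.Nullary using (¬_; does; yes; no; contradiction)
open import Relation.Nullary.Decidable using (_→-dec_; decidable-stable; dec-true; toWitness; isYes; isYes≗does)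
open import Relation.Unary as U using (Pred; _⊆_)

single-true : ℕ → ℕ → List Bool
single-true i j = replicate i false ++ true ∷ replicate j false

module _ {m : ℕ} where

  occ : Fin m → List (Fin m) → ℕ
  occ u = length ∘ filter (_≟ u)

  occ-++ : ∀ u xs ys → occ u (xs ++ ys) ≡ occ u xs + occ u ys
  occ-++ u xs ys = trans (cong length (filter-++ (_≟ u) xs ys)) (length-++ (filter (_≟ u) xs))

  occ-self-∷ : ∀ (x : Fin m) w → occ x (x ∷ w) ≡ suc (occ x w)
  occ-self-∷ x w = cong length (filter-accept (_≟ x) {x} {w} refl)

  occ-other-∷ : ∀ {u x : Fin m} w → x ≢ u → occ u (x ∷ w) ≡ occ u w
  occ-other-∷ {u} w x≢u = cong length (filter-reject (_≟ u) {xs = w} x≢u)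

  occ-replicate-self : ∀ k (u : Fin m) → occ u (replicate k u) ≡ k
  occ-replicate-self k u = trans (cong length (filter-all (_≟ u) (replicate⁺ k refl))) (length-replicate k)

  occ-replicate-other : ∀ k {u x : Fin m} → x ≢ u → occ u (replicate k x) ≡ 0
  occ-replicate-other k {u} x≢u = cong length (filter-none (_≟ u) (replicate⁺ k x≢u))

  occ-suffix-mono : ∀ u {s t : List (Fin m)} → Suffix _≡_ s t → occ u s ≤ occ u t
  occ-suffix-mono u = length-mono ∘ filter⁺ (_≟ u) (_≟ u) (λ { refl x≡u → x≡u }) (λ { refl x≡u → x≡u })

  occ>0⇒∈ : ∀ {u} w → 0 < occ u w → u ∈ w
  occ>0⇒∈ {u} (x ∷ w) pos with x ≟ u
  ... | yes refl = here refl
  ... | no _ = there (occ>0⇒∈ w pos)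

  h-++ : ∀ (u v : Fin m) xs ys → h u v (xs ++ ys) ≡ h u v xs ++ h u v ys
  h-++ u v [] ys = refl
  h-++ u v (x ∷ xs) ys with x ≟ u | x ≟ v
  ... | yes _ | _     = cong (false ∷_) (h-++ u v xs ys)
  ... | no _  | yes _ = cong (true ∷_) (h-++ u v xs ys)
  ... | no _  | no _  = h-++ u v xs ys

  h-falses : ∀ {u v : Fin m} w → u ≢ v → length (filterᵇ not (h u v w)) ≡ occ u w
  h-falses [] u≢v = refl
  h-falses {u} {v} (x ∷ w) u≢v with x ≟ u | x ≟ v
  ... | yes _ | _     = cong suc (h-falses w u≢v)
  ... | no _  | yes _ = h-falses w u≢v
  ... | no _  | no _  = h-falses w u≢v

  h-trues : ∀ {u v : Fin m} w → u ≢ v → length (filterᵇ id (h u v w)) ≡ occ v w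
  h-trues [] u≢v = refl
  h-trues {u} {v} (x ∷ w) u≢v with x ≟ u | x ≟ v
  ... | yes refl | yes refl = ⊥-elim (u≢v refl)
  ... | yes _    | no _     = h-trues w u≢v
  ... | no _     | yes _    = cong suc (h-trues w u≢v)
  ... | no _     | no _     = h-trues w u≢v

  h-right-∷ : ∀ {u v : Fin m} w → u ≢ v → h u v (v ∷ w) ≡ true ∷ h u v w
  h-right-∷ {u} {v} w u≢v with v ≟ u | v ≟ v
  ... | yes v≡u | _      = ⊥-elim (u≢v (sym v≡u))
  ... | no _    | yes _  = refl
  ... | no _    | no v≢v = ⊥-elim (v≢v refl)

  h-right-absent : ∀ {u v : Fin m} w → occ v w ≡ 0 → h u v w ≡ replicate (occ u w) false
  h-right-absent [] _ = refl
  h-right-absent {u} {v} (x ∷ w) v∉w with x ≟ v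
  h-right-absent {u} {v} (x ∷ w) () | yes _
  ... | no _ with x ≟ u
  ...   | yes _ = cong (false ∷_) (h-right-absent w v∉w)
  ...   | no _  = h-right-absent w v∉w

  h-replicate-left : ∀ k {u v : Fin m} → u ≢ v → h u v (replicate k u) ≡ replicate k false
  h-replicate-left k {u} u≢v =
    trans (h-right-absent (replicate k u) (occ-replicate-other k u≢v))
          (cong (λ i → replicate i false) (occ-replicate-self k u))

  h-replicate-right : ∀ k {u v : Fin m} → u ≢ v → h u v (replicate k v) ≡ replicate k true
  h-replicate-right zero u≢v = refl
  h-replicate-right (suc k) {v = v} u≢v =
    trans (h-right-∷ (replicate k v) u≢v) (cong (true ∷_) (h-replicate-right k u≢v))

  h-replicate-other : ∀ k {u v x : Fin m} → x ≢ u → x ≢ v → h u v (replicate k x) ≡ []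
  h-replicate-other k x≢u x≢v =
    trans (h-right-absent (replicate k _) (occ-replicate-other k x≢v))
          (cong (λ i → replicate i false) (occ-replicate-other k x≢u))

  after : Fin m → List (Fin m) → List (Fin m)
  after x [] = []
  after x (c ∷ w) with c ≟ x
  ... | yes _ = w
  ... | no _  = after x w

  after-suffix : ∀ x w → Suffix _≡_ (after x w) w
  after-suffix x [] = here (Pointwise.refl refl)
  after-suffix x (c ∷ w) with c ≟ x
  ... | yes _ = there (here (Pointwise.refl refl))
  ... | no _  = there (after-suffix x w)

  after-comparable : ∀ x y w → Suffix _≡_ (after x w) (after y w) ⊎ Suffix _≡_ (after y w) (after x w)
  after-comparable x y [] = inj₁ (here (Pointwise.refl refl))
  after-comparable x y (c ∷ w) with c ≟ x | c ≟ y
  ... | yes _ | yes _ = inj₁ (here (Pointwise.refl refl))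
  ... | yes _ | no _  = inj₂ (after-suffix y w)
  ... | no _  | yes _ = inj₁ (after-suffix x w)
  ... | no _  | no _  = after-comparable x y w

  split-at-first : ∀ x w → 0 < occ x w → ∃ λ p → w ≡ p ++ x ∷ after x w × occ x p ≡ 0
  split-at-first x (c ∷ w) pos with c ≟ x
  ... | yes refl = [] , refl , refl
  ... | no c≢x with split-at-first x w pos
  ...   | p , w≡ , x∉p = c ∷ p , cong (c ∷_) w≡ , trans (occ-other-∷ p c≢x) x∉p

  h-at-unique : ∀ {u x} w → u ≢ x → occ x w ≡ 1 →
                ∃ λ i → h u x w ≡ single-true i (occ u (after x w)) × i + occ u (after x w) ≡ occ u w
  h-at-unique {u} {x} w u≢x once with split-at-first x w (subst (0 <_) (sym once) (s≤s z≤n))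
  ... | p , w≡ , x∉p = occ u p , h-split , sym occ-split
    where
    open ≡-Reasoning
    s = after x w
    x∉s : occ x s ≡ 0
    x∉s = ℕ.suc-injective (begin
      suc (occ x s)           ≡⟨ occ-self-∷ x s ⟨
      occ x (x ∷ s)           ≡⟨ cong (_+ occ x (x ∷ s)) x∉p ⟨
      occ x p + occ x (x ∷ s) ≡⟨ occ-++ x p (x ∷ s) ⟨
      occ x (p ++ x ∷ s)      ≡⟨ cong (occ x) w≡ ⟨
      occ x w                 ≡⟨ once ⟩
      1                       ∎)
    h-split : h u x w ≡ single-true (occ u p) (occ u s)
    h-split = begin
      h u x w                                     ≡⟨ cong (h u x) w≡ ⟩
      h u x (p ++ x ∷ s)                          ≡⟨ h-++ u x p (x ∷ s) ⟩
      h u x p ++ h u x (x ∷ s)                    ≡⟨ cong (h u x p ++_) (h-right-∷ s u≢x) ⟩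
      h u x p ++ true ∷ h u x s                   ≡⟨ cong₂ (λ l r → l ++ true ∷ r) (h-right-absent p x∉p)
                                                                                  (h-right-absent s x∉s) ⟩
      replicate (occ u p) false ++ true ∷ replicate (occ u s) false ∎
    occ-split : occ u w ≡ occ u p + occ u s
    occ-split = begin
      occ u w                  ≡⟨ cong (occ u) w≡ ⟩
      occ u (p ++ x ∷ s)       ≡⟨ occ-++ u p (x ∷ s) ⟩
      occ u p + occ u (x ∷ s)  ≡⟨ cong (occ u p +_) (occ-other-∷ s (u≢x ∘ sym)) ⟩
      occ u p + occ u s        ∎

inL-true-cases : ∀ l → inL l ≡ true → l ≡ false ∷ false ∷ true ∷ [] ⊎ l ≡ true ∷ true ∷ false ∷ []
inL-true-cases (false ∷ false ∷ true ∷ []) _ = inj₁ refl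
inL-true-cases (true ∷ true ∷ false ∷ []) _ = inj₂ refl
inL-true-cases [] ()
inL-true-cases (false ∷ []) ()
inL-true-cases (true ∷ []) ()
inL-true-cases (false ∷ false ∷ []) ()
inL-true-cases (false ∷ true ∷ _) ()
inL-true-cases (true ∷ false ∷ _) ()
inL-true-cases (true ∷ true ∷ []) ()
inL-true-cases (false ∷ false ∷ false ∷ _) ()
inL-true-cases (true ∷ true ∷ true ∷ _) ()
inL-true-cases (false ∷ false ∷ true ∷ _ ∷ _) ()
inL-true-cases (true ∷ true ∷ false ∷ _ ∷ _) ()

inL-single-true : ∀ i j → inL (single-true i j) ≡ true → i ≡ 2 × j ≡ 0
inL-single-true 2 0 _ = refl , refl
inL-single-true 0 0 ()
inL-single-true 0 1 ()
inL-single-true 0 (suc (suc _)) ()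
inL-single-true 1 0 ()
inL-single-true 1 (suc _) ()
inL-single-true 2 (suc _) ()
inL-single-true (suc (suc (suc _))) _ ()

module _ {m : ℕ} (w : List (Fin m)) where

  GLw-irrefl : ∀ u → GLw w u u ≡ false
  GLw-irrefl u with u ≟ u
  ... | yes _ = refl
  ... | no u≢u = contradiction refl u≢u

  GLw-distinct : ∀ {u v} → u ≢ v → GLw w u v ≡ inL (h u v w)
  GLw-distinct {u} {v} u≢v with u ≟ v
  ... | yes u≡v = contradiction u≡v u≢v
  ... | no _ = refl

  GLw-edge-distinct : ∀ {u v} → GLw w u v ≡ true → u ≢ v
  GLw-edge-distinct {u} uv refl with () ← trans (sym (GLw-irrefl u)) uv

  GLw-edge-occurrences : ∀ {u v} → GLw w u v ≡ true →
                         occ u w ≡ 2 × occ v w ≡ 1 ⊎ occ u w ≡ 1 × occ v w ≡ 2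
  GLw-edge-occurrences {u} {v} uv =
    Sum.map counts counts (inL-true-cases (h u v w) (trans (sym (GLw-distinct u≢v)) uv))
    where
    u≢v = GLw-edge-distinct uv
    counts : ∀ {l} → h u v w ≡ l → occ u w ≡ length (filterᵇ not l) × occ v w ≡ length (filterᵇ id l)
    counts refl = sym (h-falses w u≢v) , sym (h-trues w u≢v)

  GLw-twice-adjacent⇔ : ∀ {a x} → occ a w ≡ 2 → GLw w a x ≡ true ⇔ (occ x w ≡ 1 × occ a (after x w) ≡ 0)
  GLw-twice-adjacent⇔ {a} {x} twice = mk⇔ to from
    where
    distinct : occ x w ≡ 1 → a ≢ x
    distinct once refl with () ← trans (sym twice) once
    to : GLw w a x ≡ true → occ x w ≡ 1 × occ a (after x w) ≡ 0
    to ax with GLw-edge-occurrences ax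
    ... | inj₂ (once , _) with () ← trans (sym twice) once
    ... | inj₁ (_ , once) with h-at-unique w (distinct once) once
    ...   | i , h≡ , _ = once , proj₂ (inL-single-true i _ (begin
      inL (single-true i (occ a (after x w))) ≡⟨ cong inL h≡ ⟨
      inL (h a x w)                           ≡⟨ GLw-distinct (distinct once) ⟨
      GLw w a x                               ≡⟨ ax ⟩
      true                                    ∎))
      where open ≡-Reasoning
    from : occ x w ≡ 1 × occ a (after x w) ≡ 0 → GLw w a x ≡ true
    from (once , a∉after) with h-at-unique w (distinct once) once
    ... | i , h≡ , i+j≡occ = begin
      GLw w a x                               ≡⟨ GLw-distinct (distinct once) ⟩
      inL (h a x w)                           ≡⟨ cong inL h≡ ⟩
      inL (single-true i (occ a (after x w))) ≡⟨ cong₂ (λ i j → inL (single-true i j)) i≡2 a∉after ⟩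
      true                                    ∎
      where
      open ≡-Reasoning
      i≡2 : i ≡ 2
      i≡2 = trans (sym (+-identityʳ i)) (trans (cong (i +_) (sym a∉after)) (trans i+j≡occ twice))

NestedBipartition : ∀ {n} → Adj n → Set
NestedBipartition {n} adj = Σ (Fin n → Bool) λ side →
  (∀ x y → adj x y ≡ true → side x ≢ side y) ×
  (∀ a b → side a ≡ true → side b ≡ true → NSub adj a b ⊎ NSub adj b a)

downsets-comparable : ∀ {ℓ p m} {_≼_ : Rel (Fin m) ℓ} → Total _≼_ →
                      {P Q : Pred (Fin m) p} → U.Decidable P → U.Decidable Q →
                      (∀ {x y} → x ≼ y → P y → P x) → (∀ {x y} → x ≼ y → Q y → Q x) →
                      P ⊆ Q ⊎ Q ⊆ P
downsets-comparable {m = m} total {P} {Q} P? Q? P-down Q-down with all? (λ x → P? x →-dec Q? x)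
... | yes P⊆Q = inj₁ (P⊆Q _)
... | no P⊈Q = inj₂ Q⊆P
  where
  witness : ∃ λ x → ¬ (P x → Q x)
  witness = ¬∀⟶∃¬ m _ (λ x → P? x →-dec Q? x) P⊈Q
  x = proj₁ witness
  Px : P x
  Px = decidable-stable (P? x) (λ ¬Px → proj₂ witness (λ Px → contradiction Px ¬Px))
  Q⊆P : Q ⊆ P
  Q⊆P {y} Qy with total x y
  ... | inj₁ x≼y = contradiction (λ _ → Q-down x≼y Qy) (proj₂ witness)
  ... | inj₂ y≼x = P-down y≼x Px

wordGraph-nested : ∀ {m} (w : List (Fin m)) → NestedBipartition (GLw w)
wordGraph-nested {m} w = twice , bipartite , nested
  where
  twice : Fin m → Bool
  twice x = occ x w ≡ᵇ 2
  twice⇒ : ∀ {a} → twice a ≡ true → occ a w ≡ 2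
  twice⇒ {a} e = ≡ᵇ⇒≡ (occ a w) 2 (Equivalence.from Bool.T-≡ e)
  bipartite : ∀ x y → GLw w x y ≡ true → twice x ≢ twice y
  bipartite x y xy with GLw-edge-occurrences w xy
  ... | inj₁ (ox , oy) rewrite ox | oy = λ ()
  ... | inj₂ (ox , oy) rewrite ox | oy = λ ()
  absent? : ∀ a → U.Decidable (λ x → occ a (after x w) ≡ 0)
  absent? a x = occ a (after x w) ℕ.≟ 0
  absent-down : ∀ a {x y} → Suffix _≡_ (after x w) (after y w) → occ a (after y w) ≡ 0 → occ a (after x w) ≡ 0
  absent-down a x≼y a∉ = n≤0⇒n≡0 (≤-trans (occ-suffix-mono a x≼y) (≤-reflexive a∉))
  nsub : ∀ {a b} → occ a w ≡ 2 → occ b w ≡ 2 →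
         (∀ {x} → occ a (after x w) ≡ 0 → occ b (after x w) ≡ 0) → NSub (GLw w) a b
  nsub ta tb absent⊆ x ax with Equivalence.to (GLw-twice-adjacent⇔ w ta) ax
  ... | once , a∉ = Equivalence.from (GLw-twice-adjacent⇔ w tb) (once , absent⊆ a∉)
  nested : ∀ a b → twice a ≡ true → twice b ≡ true → NSub (GLw w) a b ⊎ NSub (GLw w) b a
  nested a b ta tb =
    Sum.map (nsub (twice⇒ ta) (twice⇒ tb)) (nsub (twice⇒ tb) (twice⇒ ta))
      (downsets-comparable (λ x y → after-comparable x y w) (absent? a) (absent? b) (absent-down a) (absent-down b))

module TieBreak {A : Set} {_≲_ : Rel A 0ℓ} (≲-isTotalPreorder : IsTotalPreorder _≡_ _≲_)
                (_≲?_ : Decidable _≲_) (ι : A → ℕ) (ι-injective : Injective _≡_ _≡_ ι) where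

  open IsTotalPreorder ≲-isTotalPreorder using () renaming (refl to ≲-refl; trans to ≲-trans; total to ≲-total)

  _⊑_ : Rel A 0ℓ
  a ⊑ b = a ≲ b × (b ≲ a → ι a ≤ ι b)

  ⊑-reflexive : _≡_ ⇒ _⊑_
  ⊑-reflexive refl = ≲-refl , const ≤-refl

  ⊑-trans : Transitive _⊑_
  ⊑-trans (a≲b , ι-ab) (b≲c , ι-bc) =
    ≲-trans a≲b b≲c , λ c≲a → ≤-trans (ι-ab (≲-trans b≲c c≲a)) (ι-bc (≲-trans c≲a a≲b))

  ⊑-antisym : Antisymmetric _≡_ _⊑_
  ⊑-antisym (a≲b , ι-ab) (b≲a , ι-ba) = ι-injective (≤-antisym (ι-ab b≲a) (ι-ba a≲b))

  ⊑-total : Total _⊑_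
  ⊑-total a b with a ≲? b | b ≲? a
  ... | yes a≲b | yes b≲a = Sum.map ((a≲b ,_) ∘ const) ((b≲a ,_) ∘ const) (≤-total (ι a) (ι b))
  ... | yes a≲b | no b≴a  = inj₁ (a≲b , λ b≲a → contradiction b≲a b≴a)
  ... | no a≴b  | yes b≲a = inj₂ (b≲a , λ a≲b → contradiction a≲b a≴b)
  ... | no a≴b  | no b≴a  = ⊥-elim ([ a≴b , b≴a ] (≲-total a b))

  ⊑-isTotalOrder : IsTotalOrder _≡_ _⊑_
  ⊑-isTotalOrder = record
    { isPartialOrder = record
      { isPreorder = record { isEquivalence = isEquivalence ; reflexive = ⊑-reflexive ; trans = ⊑-trans }
      ; antisym = ⊑-antisym }
    ; total = ⊑-total }

nsub? : ∀ {n} (adj : Adj n) → Decidable (NSub adj)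
nsub? adj a b = all? λ x → (adj a x Bool.≟ true) →-dec (adj b x Bool.≟ true)

NSub-isPreorder : ∀ {n} (adj : Adj n) → IsPreorder _≡_ (NSub adj)
NSub-isPreorder adj = record
  { isEquivalence = isEquivalence
  ; reflexive = λ { refl x ax → ax }
  ; trans = λ a⊆b b⊆c x → b⊆c x ∘ a⊆b x }

nested⇒chain : ∀ {n} {adj : Adj n} → NestedBipartition adj → IsBipartiteChain adj
nested⇒chain {adj = adj} (side , bipartite , nested) =
  side , bipartite , _⊑_ , ⊑-isTotalOrder , λ _ _ → proj₁
  where
  NSub-isTotalPreorder : IsTotalPreorder _≡_ (NSub adj on proj₁)
  NSub-isTotalPreorder = record
    { isPreorder = record { isEquivalence = isEquivalence ; reflexive = λ { refl → NSub-refl } ; trans = NSub-trans }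
    ; total = λ (a , sa) (b , sb) → nested a b sa sb }
    where open IsPreorder (NSub-isPreorder adj) using () renaming (refl to NSub-refl; trans to NSub-trans)
  index-injective : Injective _≡_ _≡_ (toℕ ∘ proj₁ {B = λ a → side a ≡ true})
  index-injective {a , sa} {b , sb} e with toℕ-injective e
  ... | refl = cong (a ,_) (Decidable⇒UIP.≡-irrelevant Bool._≟_ sa sb)
  open TieBreak NSub-isTotalPreorder (λ a b → nsub? adj (proj₁ a) (proj₁ b)) (toℕ ∘ proj₁) index-injective

chain⇒nested : ∀ {n} {adj : Adj n} → IsBipartiteChain adj → NestedBipartition adj
chain⇒nested (side , bipartite , _ , isTotalOrder , monotone) = side , bipartite , λ a b sa sb →
  Sum.map (monotone _ _) (monotone _ _) (IsTotalOrder.total isTotalOrder (a , sa) (b , sb))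

nested-transport : ∀ {m n} {adjG : Adj m} {adjH : Adj n} → Iso adjG adjH →
                   NestedBipartition adjG → NestedBipartition adjH
nested-transport {adjG = adjG} {adjH} (f , preserves) (side , bipartite , nested) =
  side ∘ from ,
  (λ x y xy → bipartite (from x) (from y) (trans (sym (reflect x y)) xy)) ,
  λ a b sa sb → Sum.map (pull a b) (pull b a) (nested (from a) (from b) sa sb)
  where
  open Inverse f
  reflect : ∀ x y → adjH x y ≡ adjG (from x) (from y)
  reflect x y = trans (sym (cong₂ adjH (strictlyInverseˡ x) (strictlyInverseˡ y))) (preserves (from x) (from y))
  pull : ∀ a b → NSub adjG (from a) (from b) → NSub adjH a b
  pull a b a⊆b x ax = trans (reflect b x) (a⊆b (from x) (trans (sym (reflect a x)) ax))

module _ {n} {P : Pred (Fin n) 0ℓ} (P? : U.Decidable P) where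

  toSubset : Subset n
  toSubset = Vec.tabulate (does ∘ P?)

  ∈-toSubset⁺ : ∀ {x} → P x → x ∈ₛ toSubset
  ∈-toSubset⁺ {x} Px = lookup⇒[]= x toSubset (trans (lookup∘tabulate _ x) (dec-true (P? x) Px))

  ∈-toSubset⁻ : ∀ {x} → x ∈ₛ toSubset → P x
  ∈-toSubset⁻ {x} x∈ = toWitness {a? = P? x} (Equivalence.from Bool.T-≡ (begin
    isYes (P? x)          ≡⟨ isYes≗does (P? x) ⟩
    does (P? x)           ≡⟨ lookup∘tabulate _ x ⟨
    Vec.lookup toSubset x ≡⟨ []=⇒lookup x∈ ⟩
    true                  ∎))
    where open ≡-Reasoning

  count : ℕ
  count = ∣ toSubset ∣

count≤n : ∀ {n} {P : Pred (Fin n) 0ℓ} (P? : U.Decidable P) → count P? ≤ n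
count≤n P? = ∣p∣≤n (toSubset P?)

count-mono : ∀ {n} {P Q : Pred (Fin n) 0ℓ} (P? : U.Decidable P) (Q? : U.Decidable Q) →
             P ⊆ Q → count P? ≤ count Q?
count-mono P? Q? P⊆Q = p⊆q⇒∣p∣≤∣q∣ (∈-toSubset⁺ Q? ∘ P⊆Q ∘ ∈-toSubset⁻ P?)

count-mono-< : ∀ {n} {P Q : Pred (Fin n) 0ℓ} (P? : U.Decidable P) (Q? : U.Decidable Q) →
               P ⊆ Q → ∀ {z} → Q z → ¬ P z → count P? < count Q?
count-mono-< P? Q? P⊆Q {z} Qz ¬Pz =
  p⊂q⇒∣p∣<∣q∣ (∈-toSubset⁺ Q? ∘ P⊆Q ∘ ∈-toSubset⁻ P? ,
               z , ∈-toSubset⁺ Q? Qz , ¬Pz ∘ ∈-toSubset⁻ P?)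

module _ {X : Set} {k N : ℕ} (key : Fin k → Fin N) (block : Fin k → List X) where

  bucket : Fin N → Fin k → List X
  bucket j x = if does (key x ≟ j) then block x else []

  level : Fin N → List X
  level j = concat (tabulate (bucket j))

  bucketWord : List X
  bucketWord = concat (tabulate level)

module FreeMonoidMorphism {X M : Set} {_∙_ : Op₂ M} {ε : M} (isMonoid : IsMonoid _≡_ _∙_ ε)
       (φ : List X → M) (φ-[] : φ [] ≡ ε) (φ-++ : ∀ xs ys → φ (xs ++ ys) ≡ φ xs ∙ φ ys) where

  open IsMonoid isMonoid using (identityˡ; identityʳ)
  open ≡-Reasoning

  φ-concat-ε : ∀ {k} (g : Fin k → List X) → (∀ i → φ (g i) ≡ ε) → φ (concat (tabulate g)) ≡ ε
  φ-concat-ε {zero} g _ = φ-[]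
  φ-concat-ε {suc k} g vanish = begin
    φ (concat (tabulate g))                      ≡⟨ φ-++ (g zero) _ ⟩
    φ (g zero) ∙ φ (concat (tabulate (g ∘ suc))) ≡⟨ cong₂ _∙_ (vanish zero) rest ⟩
    ε ∙ ε                                        ≡⟨ identityˡ ε ⟩
    ε                                            ∎
    where rest = φ-concat-ε (g ∘ suc) (vanish ∘ suc)

  φ-concat-single : ∀ {k} (g : Fin k → List X) i → (∀ j → j ≢ i → φ (g j) ≡ ε) →
                    φ (concat (tabulate g)) ≡ φ (g i)
  φ-concat-single g zero vanish = begin
    φ (concat (tabulate g))                      ≡⟨ φ-++ (g zero) _ ⟩
    φ (g zero) ∙ φ (concat (tabulate (g ∘ suc))) ≡⟨ cong (φ (g zero) ∙_) rest ⟩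
    φ (g zero) ∙ ε                               ≡⟨ identityʳ _ ⟩
    φ (g zero)                                   ∎
    where rest = φ-concat-ε (g ∘ suc) λ j → vanish (suc j) λ ()
  φ-concat-single g (suc i) vanish = begin
    φ (concat (tabulate g))                      ≡⟨ φ-++ (g zero) _ ⟩
    φ (g zero) ∙ φ (concat (tabulate (g ∘ suc))) ≡⟨ cong₂ _∙_ (vanish zero λ ()) rest ⟩
    ε ∙ φ (g (suc i))                            ≡⟨ identityˡ _ ⟩
    φ (g (suc i))                                ∎
    where rest = φ-concat-single (g ∘ suc) i λ j j≢i → vanish (suc j) (j≢i ∘ suc-injective)

  φ-concat-pair : ∀ {k} (g : Fin k → List X) {i j} → i Fin.< j → (∀ l → l ≢ i → l ≢ j → φ (g l) ≡ ε) →
                  φ (concat (tabulate g)) ≡ φ (g i) ∙ φ (g j)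
  φ-concat-pair g {zero} {suc j} _ vanish = begin
    φ (concat (tabulate g))                      ≡⟨ φ-++ (g zero) _ ⟩
    φ (g zero) ∙ φ (concat (tabulate (g ∘ suc))) ≡⟨ cong (φ (g zero) ∙_) rest ⟩
    φ (g zero) ∙ φ (g (suc j))                   ∎
    where rest = φ-concat-single (g ∘ suc) j λ l l≢j → vanish (suc l) (λ ()) (l≢j ∘ suc-injective)
  φ-concat-pair g {suc i} {suc j} (s≤s i<j) vanish = begin
    φ (concat (tabulate g))                      ≡⟨ φ-++ (g zero) _ ⟩
    φ (g zero) ∙ φ (concat (tabulate (g ∘ suc))) ≡⟨ cong₂ _∙_ (vanish zero (λ ()) (λ ())) rest ⟩
    ε ∙ (φ (g (suc i)) ∙ φ (g (suc j)))          ≡⟨ identityˡ _ ⟩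
    φ (g (suc i)) ∙ φ (g (suc j))                ∎
    where
    rest = φ-concat-pair (g ∘ suc) i<j λ l l≢i l≢j →
             vanish (suc l) (l≢i ∘ suc-injective) (l≢j ∘ suc-injective)

  module _ {k N} (key : Fin k → Fin N) (block : Fin k → List X) where

    φ-level-ε : ∀ j → (∀ x → key x ≡ j → φ (block x) ≡ ε) → φ (level key block j) ≡ ε
    φ-level-ε j vanish = φ-concat-ε _ φ-bucket
      where
      φ-bucket : ∀ x → φ (bucket key block j x) ≡ ε
      φ-bucket x with key x ≟ j
      ... | yes kx≡j = vanish x kx≡j
      ... | no _     = φ-[]

    φ-level-single : ∀ x → (∀ y → y ≢ x → key y ≡ key x → φ (block y) ≡ ε) →
                     φ (level key block (key x)) ≡ φ (block x)
    φ-level-single x vanish = trans (φ-concat-single _ x φ-bucket) (cong φ hit)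
      where
      φ-bucket : ∀ y → y ≢ x → φ (bucket key block (key x) y) ≡ ε
      φ-bucket y y≢x with key y ≟ key x
      ... | yes ky≡kx = vanish y y≢x ky≡kx
      ... | no _      = φ-[]
      hit : bucket key block (key x) x ≡ block x
      hit rewrite dec-true (key x ≟ key x) refl = refl

    φ-bucketWord-single : ∀ x → (∀ y → y ≢ x → φ (block y) ≡ ε) → φ (bucketWord key block) ≡ φ (block x)
    φ-bucketWord-single x vanish = begin
      φ (bucketWord key block)    ≡⟨ φ-concat-single _ (key x) other-levels ⟩
      φ (level key block (key x)) ≡⟨ φ-level-single x (λ y y≢x _ → vanish y y≢x) ⟩
      φ (block x)                 ∎
      where
      other-levels : ∀ j → j ≢ key x → φ (level key block j) ≡ ε
      other-levels j j≢kx = φ-level-ε j λ { y refl → vanish y λ { refl → j≢kx refl } }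

    φ-bucketWord-pair : ∀ {x y} → key x Fin.< key y → (∀ z → z ≢ x → z ≢ y → φ (block z) ≡ ε) →
                        φ (bucketWord key block) ≡ φ (block x) ∙ φ (block y)
    φ-bucketWord-pair {x} {y} kx<ky vanish = begin
      φ (bucketWord key block)                                  ≡⟨ φ-concat-pair _ kx<ky other-levels ⟩
      φ (level key block (key x)) ∙ φ (level key block (key y)) ≡⟨ cong₂ _∙_ (φ-level-single x only-x)
                                                                               (φ-level-single y only-y) ⟩
      φ (block x) ∙ φ (block y)                                 ∎
      where
      other-levels : ∀ j → j ≢ key x → j ≢ key y → φ (level key block j) ≡ ε
      other-levels j j≢kx j≢ky =
        φ-level-ε j λ { z refl → vanish z (λ { refl → j≢kx refl }) (λ { refl → j≢ky refl }) }
      only-x : ∀ z → z ≢ x → key z ≡ key x → φ (block z) ≡ ε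
      only-x z z≢x kz≡kx = vanish z z≢x λ { refl → <-irrefl (sym kz≡kx) kx<ky }
      only-y : ∀ z → z ≢ y → key z ≡ key y → φ (block z) ≡ ε
      only-y z z≢y kz≡ky = vanish z (λ { refl → <-irrefl kz≡ky kx<ky }) z≢y

module NestedBipartitionWord {n} {adj : Adj n}
         (adj-sym : ∀ x y → adj x y ≡ adj y x) (adj-irrefl : ∀ x → adj x x ≡ false)
         (side : Fin n → Bool) (bipartite : ∀ x y → adj x y ≡ true → side x ≢ side y)
         (nested : ∀ a b → side a ≡ true → side b ≡ true → NSub adj a b ⊎ NSub adj b a) where

  adjacent? : ∀ b → U.Decidable (λ v → adj b v ≡ true)
  adjacent? b v = adj b v Bool.≟ true

  up deg : Fin n → ℕ
  up a = count (nsub? adj a)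
  deg b = count (adjacent? b)

  up≤deg : ∀ {a b} → adj a b ≡ true → up a ≤ deg b
  up≤deg {a} {b} ab = count-mono (nsub? adj a) (adjacent? b) λ {v} a⊆v → trans (adj-sym b v) (a⊆v b ab)

  deg<up : ∀ {a b} → side a ≡ true → side b ≡ false → adj a b ≡ false → deg b < up a
  deg<up {a} {b} sa sb ¬ab = count-mono-< (adjacent? b) (nsub? adj a) neighbour⇒above {a} (λ _ ax → ax) ¬ba
    where
    ¬ba : adj b a ≢ true
    ¬ba ba with () ← trans (sym ba) (trans (adj-sym b a) ¬ab)
    neighbour⇒above : ∀ {v} → adj b v ≡ true → NSub adj a v
    neighbour⇒above {v} bv
      with nested a v sa (trans (Bool.¬-not (bipartite v b (trans (adj-sym v b) bv))) (cong not sb))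
    ... | inj₁ a⊆v = a⊆v
    ... | inj₂ v⊆a with () ← trans (sym (v⊆a b (trans (adj-sym v b) bv))) ¬ab

  rankBySide : Bool → Fin n → ℕ
  rankBySide true a = up a + up a
  rankBySide false b = suc (deg b + deg b)

  rank : Fin n → ℕ
  rank x = rankBySide (side x) x

  rank<bound : ∀ x → rank x < 2 + (n + n)
  rank<bound x with side x
  ... | true  = s≤s (m≤n⇒m≤1+n (+-mono-≤ (count≤n (nsub? adj x)) (count≤n (nsub? adj x))))
  ... | false = s≤s (s≤s (+-mono-≤ (count≤n (adjacent? x)) (count≤n (adjacent? x))))

  adjacent⇒rank< : ∀ {a b} → side a ≡ true → side b ≡ false → adj a b ≡ true → rank a < rank b
  adjacent⇒rank< sa sb ab rewrite sa | sb = s≤s (+-mono-≤ (up≤deg ab) (up≤deg ab))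

  nonadjacent⇒rank> : ∀ {a b} → side a ≡ true → side b ≡ false → adj a b ≡ false → rank b < rank a
  nonadjacent⇒rank> {a} {b} sa sb ¬ab rewrite sa | sb =
    subst (_≤ up a + up a) (cong suc (+-suc (deg b) (deg b))) (+-mono-≤ (deg<up sa sb ¬ab) (deg<up sa sb ¬ab))

  key : Fin n → Fin (2 + (n + n))
  key x = fromℕ< (rank<bound x)

  key-< : ∀ {x y} → rank x < rank y → key x Fin.< key y
  key-< {x} {y} = subst₂ _<_ (sym (toℕ-fromℕ< (rank<bound x))) (sym (toℕ-fromℕ< (rank<bound y)))

  multiplicity : Bool → ℕ
  multiplicity true = 2
  multiplicity false = 1

  copies : Fin n → ℕ
  copies x = multiplicity (side x)

  block : Fin n → List (Fin n)
  block x = replicate (copies x) x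

  word : List (Fin n)
  word = bucketWord key block

  occ-word : ∀ u → occ u word ≡ copies u
  occ-word u = trans (Occ.φ-bucketWord-single key block u λ x x≢u → occ-replicate-other (copies x) x≢u)
                     (occ-replicate-self (copies u) u)
    where module Occ = FreeMonoidMorphism +-0-isMonoid (occ u) refl (occ-++ u)

  word-allOccur : AllOccur word
  word-allOccur u = occ>0⇒∈ word (subst (0 <_) (sym (occ-word u)) (positive (side u)))
    where
    positive : ∀ s → 0 < multiplicity s
    positive true = s≤s z≤n
    positive false = s≤s z≤n

  h-word-< : ∀ {u v} → u ≢ v → rank u < rank v →
             h u v word ≡ replicate (copies u) false ++ replicate (copies v) true
  h-word-< {u} {v} u≢v ru<rv =
    trans (H.φ-bucketWord-pair key block (key-< ru<rv) λ z z≢u z≢v → h-replicate-other (copies z) z≢u z≢v)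
          (cong₂ _++_ (h-replicate-left (copies u) u≢v) (h-replicate-right (copies v) u≢v))
    where module H = FreeMonoidMorphism ++-isMonoid (h u v) refl (h-++ u v)

  h-word-> : ∀ {u v} → u ≢ v → rank v < rank u →
             h u v word ≡ replicate (copies v) true ++ replicate (copies u) false
  h-word-> {u} {v} u≢v rv<ru =
    trans (H.φ-bucketWord-pair key block (key-< rv<ru) λ z z≢v z≢u → h-replicate-other (copies z) z≢u z≢v)
          (cong₂ _++_ (h-replicate-right (copies v) u≢v) (h-replicate-left (copies u) u≢v))
    where module H = FreeMonoidMorphism ++-isMonoid (h u v) refl (h-++ u v)

  falses-then-trues trues-then-falses : Bool → Bool → Bool
  falses-then-trues s t = inL (replicate (multiplicity s) false ++ replicate (multiplicity t) true)
  trues-then-falses s t = inL (replicate (multiplicity t) true ++ replicate (multiplicity s) false)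

  inL-word-across : ∀ {a b} → side a ≡ true → side b ≡ false → a ≢ b →
                    inL (h a b word) ≡ adj a b × inL (h b a word) ≡ adj b a
  inL-word-across {a} {b} sa sb a≢b with adj a b in ab
  ... | true =
    trans (cong inL (h-word-< a≢b a<b)) (cong₂ falses-then-trues sa sb) ,
    trans (cong inL (h-word-> (a≢b ∘ sym) a<b))
          (trans (cong₂ trues-then-falses sb sa) (trans (sym ab) (adj-sym a b)))
    where a<b = adjacent⇒rank< sa sb ab
  ... | false =
    trans (cong inL (h-word-> a≢b b<a)) (cong₂ trues-then-falses sa sb) ,
    trans (cong inL (h-word-< (a≢b ∘ sym) b<a))
          (trans (cong₂ falses-then-trues sb sa) (trans (sym ab) (adj-sym a b)))
    where b<a = nonadjacent⇒rank> sa sb ab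

  inL-word-same-side : ∀ {u v} → side u ≡ side v → u ≢ v → inL (h u v word) ≡ adj u v
  inL-word-same-side {u} {v} su≡sv u≢v =
    trans (Bool.¬-not not-in-L) (sym (Bool.¬-not λ uv → bipartite u v uv su≡sv))
    where
    equal-occ : occ u word ≡ occ v word
    equal-occ = trans (occ-word u) (trans (cong multiplicity su≡sv) (sym (occ-word v)))
    not-in-L : inL (h u v word) ≢ true
    not-in-L uv with GLw-edge-occurrences word (trans (GLw-distinct word u≢v) uv)
    ... | inj₁ (twice , once) with () ← trans (sym twice) (trans equal-occ once)
    ... | inj₂ (once , twice) with () ← trans (sym once) (trans equal-occ twice)

  GLw-word : ∀ u v → GLw word u v ≡ adj u v
  GLw-word u v with u ≟ v
  ... | yes refl = sym (adj-irrefl u)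
  ... | no u≢v with side u in su | side v in sv
  ...   | true  | false = proj₁ (inL-word-across su sv u≢v)
  ...   | false | true  = proj₂ (inL-word-across sv su (u≢v ∘ sym))
  ...   | true  | true  = inL-word-same-side (trans su (sym sv)) u≢v
  ...   | false | false = inL-word-same-side (trans su (sym sv)) u≢v

nested⇒InGL : ∀ {n} {adj : Adj n} → IsSimple adj → NestedBipartition adj → InGL adj
nested⇒InGL {n} (adj-sym , adj-irrefl) (side , bipartite , nested) =
  n , word , word-allOccur , ↔-refl , λ u v → sym (GLw-word u v)
  where open NestedBipartitionWord adj-sym adj-irrefl side bipartite nested

mainTheorem19 : ∀ (n : ℕ) (adj : Adj n) → NonZero n → IsSimple adj →
                  InGL adj ⇔ IsBipartiteChain adj
mainTheorem19 n adj _ simple = mk⇔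
  (λ (m , w , _ , iso) → nested⇒chain (nested-transport iso (wordGraph-nested w)))
  (nested⇒InGL simple ∘ chain⇒nested)
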